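{- Let $k\ge 2$ and let $u_i,u_j$ be two distinct outer vertices of $GP(2k+1,2)$ with $r=|i-j|\le k$. Then the number $\sigma(u_i,u_j)$ of geodesics between $u_i$ and $u_j$ is $$\sigma(u_i,u_j)=\begin{cases}1 & r=1,2,3,\\ 2 & r=4,\\ 3 & r=5,\ r<k,\\ 4 & r=5,\ r=k,\\ 1 & r=6,8,10,\ldots,\\ 2 & r=7,9,11,\ldots,\ r<k,\\ 3 & r=7,9,11,\ldots,\ r=k.\end{cases}$$
   Context: For an integer $n\ge 5$, $GP(n,2)$ is the graph with vertex set $\{u_0,\dots,u_{n-1},v_0,\dots,v_{n-1}\}$ and edges $u_iu_{i+1}$ (outer edges), $u_iv_i$ (spokes) and $v_iv_{i+2}$ (inner edges) for $0\le i\le n-1$, subscripts modulo $n$. The $u_i$ are outer vertices (forming the outer cycle), the $v_i$ inner vertices. A geodesic is a shortest path; $\sigma(x,y)$ denotes the number of geodesics between $x$ and $y$. -}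

module Defs where

open import Data.Nat using (ℕ; zero; suc; _+_; _≤_; NonZero)
open import Data.Nat.DivMod using (_%_)
open import Data.Fin using (Fin; toℕ)
open import Data.List using (List; []; _∷_; length)
open import Data.List.Membership.Propositional using (_∈_)
open import Data.List.Relation.Unary.All using (All)
open import Data.List.Relation.Unary.Unique.Propositional using (Unique)
open import Data.Product using (Σ; _×_)
open import Data.Sum using (_⊎_)
open import Relation.Binary.PropositionalEquality using (_≡_)

data V (n : ℕ) : Set where
  u : Fin n → V n
  v : Fin n → V n

_≡_+_mod_ : ℕ → ℕ → ℕ → (n : ℕ) → {{NonZero n}} → Set
j ≡ i + s mod n = j ≡ (i + s) % n

data Adj (n : ℕ) {{_ : NonZero n}} : V n → V n → Set where
  outer⁺ : ∀ {i j : Fin n} → toℕ j ≡ toℕ i + 1 mod n → Adj n (u i) (u j)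
  outer⁻ : ∀ {i j : Fin n} → toℕ i ≡ toℕ j + 1 mod n → Adj n (u i) (u j)
  spoke⁺ : ∀ {i : Fin n} → Adj n (u i) (v i)
  spoke⁻ : ∀ {i : Fin n} → Adj n (v i) (u i)
  inner⁺ : ∀ {i j : Fin n} → toℕ j ≡ toℕ i + 2 mod n → Adj n (v i) (v j)
  inner⁻ : ∀ {i j : Fin n} → toℕ i ≡ toℕ j + 2 mod n → Adj n (v i) (v j)

data IsWalk (n : ℕ) {{_ : NonZero n}} : V n → V n → List (V n) → Set where
  here : ∀ {x} → IsWalk n x x (x ∷ [])
  step : ∀ {x y z ws} → Adj n x y → IsWalk n y z (y ∷ ws) → IsWalk n x z (x ∷ y ∷ ws)

-- A geodesic: a walk from x to y of minimum length among all x–y walks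
-- (such a walk is automatically a path).
IsGeodesic : (n : ℕ) {{_ : NonZero n}} → V n → V n → List (V n) → Set
IsGeodesic n x y ws =
  IsWalk n x y ws × (∀ ws′ → IsWalk n x y ws′ → length ws ≤ length ws′)

σ_,_≡_in-GP2_ : {n : ℕ} {{_ : NonZero n}} → V n → V n → ℕ → Set
σ_,_≡_in-GP2_ {n} x y m =
  Σ (List (List (V n))) λ L →
    Unique L × All (IsGeodesic n x y) L
    × (∀ ws → IsGeodesic n x y ws → ws ∈ L) × length L ≡ m

module Submission where

-- Write t ≤ k for the cyclic distance of an index from j. The distance to u_j from the outer and
-- the inner vertex at position t is guessed as outerDist t and innerDist t, the number of geodesics
-- as outerCount t and innerCount t, and both guesses are verified locally. The potential built from
-- the distance formulas changes by at most one along every edge and vanishes only at u_j, so it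
-- bounds the length of every walk to u_j; hence the walks on which it drops at every step are exactly
-- the geodesics. Their number obeys the recurrence of summing over the neighbours one step closer, which
-- the count formulas satisfy, so σ(u_i, u_j) = outerCount |i - j|, evaluated case by case.

open import Defs
open import Data.Bool using (true; false; if_then_else_)
open import Data.Bool.Properties using (T-≡)
open import Data.Empty using (⊥-elim)
open import Data.Fin using (Fin; toℕ; fromℕ<)
open import Data.Fin.Properties using (toℕ-fromℕ<; toℕ-injective; toℕ<n)
open import Data.List using (List; []; _∷_; length; map; _++_)
open import Data.List.Properties using (length-++; length-map; ∷-injectiveˡ; ∷-injectiveʳ)
open import Data.List.Membership.Propositional using (_∈_)
open import Data.List.Membership.Propositional.Properties using (∈-map⁻; ∈-map⁺; ∈-++⁻; ∈-++⁺ˡ; ∈-++⁺ʳ)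
open import Data.List.Relation.Unary.Any using (here; there)
open import Data.List.Relation.Unary.All using ([]; _∷_)
import Data.List.Relation.Unary.All as All
open import Data.List.Relation.Unary.AllPairs using ([]; _∷_)
open import Data.List.Relation.Unary.Unique.Propositional using (Unique)
open import Data.List.Relation.Unary.Unique.Propositional.Properties using (++⁺; map⁺)
open import Data.Nat
open import Data.Nat.DivMod
open import Data.Nat.Properties
open import Algebra.Properties.CommutativeSemigroup +-commutativeSemigroup using () renaming (interchange to +-interchange)
open import Data.Product using (_×_; _,_; proj₁; proj₂; ∃; ∃₂; map₁; map₂)
open import Data.Sum using (_⊎_; inj₁; inj₂; [_,_])
open import Function using (_∘_; Equivalence)
open import Relation.Nullary using (¬_; yes; no)
open import Relation.Binary.PropositionalEquality
  using (_≡_; _≢_; refl; sym; trans; cong; cong₂; subst; module ≡-Reasoning)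

≡ᵇ≡true⇒≡ : ∀ {m n} → (m ≡ᵇ n) ≡ true → m ≡ n
≡ᵇ≡true⇒≡ {m} {n} eq = ≡ᵇ⇒≡ m n (Equivalence.from T-≡ eq)

≡⇒≡ᵇ≡true : ∀ {m n} → m ≡ n → (m ≡ᵇ n) ≡ true
≡⇒≡ᵇ≡true {m} {n} eq = Equivalence.to T-≡ (≡⇒≡ᵇ m n eq)

≢⇒≡ᵇ≡false : ∀ {m n} → m ≢ n → (m ≡ᵇ n) ≡ false
≢⇒≡ᵇ≡false {m} {n} m≢n with m ≡ᵇ n in eq
... | false = refl
... | true  = ⊥-elim (m≢n (≡ᵇ≡true⇒≡ eq))

module Descent {n : ℕ} {{_ : NonZero n}} (target : V n) (h : V n → ℕ)
  (nbrs : V n → List (V n))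
  (∈nbrs⇒Adj : ∀ {x y} → y ∈ nbrs x → Adj n x y)
  (Adj⇒∈nbrs : ∀ {x y} → Adj n x y → y ∈ nbrs x)
  (nbrs-unique : ∀ x → Unique (nbrs x))
  (h-lipschitz : ∀ {x y} → Adj n x y → h x ≤ suc (h y))
  (h≡0⇒target : ∀ {x} → h x ≡ 0 → x ≡ target)
  (h-target : h target ≡ 0)
  where

  Walk : Set
  Walk = List (V n)

  descents : V n → ℕ → List Walk
  descentsVia : V n → ℕ → List (V n) → List Walk
  descents x zero = if h x ≡ᵇ 0 then (x ∷ []) ∷ [] else []
  descents x (suc m) = descentsVia x m (nbrs x)
  descentsVia x m [] = []
  descentsVia x m (y ∷ ys) =
    (if h y ≡ᵇ m then map (x ∷_) (descents y m) else []) ++ descentsVia x m ys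

  sumAtLevel : (V n → ℕ) → ℕ → List (V n) → ℕ
  sumAtLevel f m [] = 0
  sumAtLevel f m (y ∷ ys) = (if h y ≡ᵇ m then f y else 0) + sumAtLevel f m ys

  IsWalk-∷ : ∀ {x y z ws} → Adj n x y → IsWalk n y z ws → IsWalk n x z (x ∷ ws)
  IsWalk-∷ a here       = step a here
  IsWalk-∷ a (step b w) = step a (step b w)

  IsWalk-head : ∀ {x z ws} → IsWalk n x z ws → ∃ λ rest → ws ≡ x ∷ rest
  IsWalk-head here       = _ , refl
  IsWalk-head (step _ _) = _ , refl

  h<length : ∀ {x ws} → IsWalk n x target ws → h x < length ws
  h<length here       rewrite h-target = s≤s z≤n
  h<length (step a w) = s≤s (≤-trans (h-lipschitz a) (h<length w))

  descents-sound : ∀ x m {ws} → ws ∈ descents x m →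
    IsWalk n x target ws × length ws ≡ suc m
  descentsVia-sound : ∀ x m ys {ws} → (∀ {y} → y ∈ ys → Adj n x y) →
    ws ∈ descentsVia x m ys → IsWalk n x target ws × length ws ≡ suc (suc m)
  descents-sound x zero mem with h x ≡ᵇ 0 in hx
  descents-sound x zero (here refl) | true rewrite h≡0⇒target (≡ᵇ≡true⇒≡ hx) = here , refl
  descents-sound x (suc m) mem = descentsVia-sound x m (nbrs x) ∈nbrs⇒Adj mem
  descentsVia-sound x m (y ∷ ys) adj mem with h y ≡ᵇ m
  ... | false = descentsVia-sound x m ys (adj ∘ there) mem
  ... | true with ∈-++⁻ (map (x ∷_) (descents y m)) mem
  ...   | inj₂ mem′ = descentsVia-sound x m ys (adj ∘ there) mem′
  ...   | inj₁ mem′ with ∈-map⁻ (x ∷_) mem′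
  ...     | ws , ws∈ , refl with descents-sound y m ws∈
  ...       | walk , len = IsWalk-∷ (adj (here refl)) walk , cong suc len

  descents-complete : ∀ x m {ws} → IsWalk n x target ws → length ws ≡ suc m → h x ≡ m →
    ws ∈ descents x m
  descentsVia-complete : ∀ x m ys {y ws} → y ∈ ys → h y ≡ m → ws ∈ descents y m →
    (x ∷ ws) ∈ descentsVia x m ys
  descents-complete x zero here _ hx rewrite hx = here refl
  descents-complete x (suc m) (step {y = y} a w) len hx =
    descentsVia-complete x m (nbrs x) (Adj⇒∈nbrs a) hy (descents-complete y m w len′ hy)
    where
    len′ = suc-injective len
    hy : h y ≡ m
    hy = ≤-antisym (≤-pred (subst (h y <_) len′ (h<length w)))
                   (≤-pred (subst (_≤ suc (h y)) hx (h-lipschitz a)))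
  descentsVia-complete x m (y ∷ ys) (here refl) hy ws∈ rewrite hy | ≡⇒≡ᵇ≡true {m} refl =
    ∈-++⁺ˡ (∈-map⁺ (x ∷_) ws∈)
  descentsVia-complete x m (z ∷ ys) (there y∈) hy ws∈ =
    ∈-++⁺ʳ (if h z ≡ᵇ m then map (x ∷_) (descents z m) else [])
           (descentsVia-complete x m ys y∈ hy ws∈)

  descentsVia-second : ∀ x m ys {ws} → ws ∈ descentsVia x m ys →
    ∃₂ λ y rest → y ∈ ys × ws ≡ x ∷ y ∷ rest
  descentsVia-second x m (y ∷ ys) mem with h y ≡ᵇ m
  ... | false = map₂ (map₂ (map₁ there)) (descentsVia-second x m ys mem)
  ... | true with ∈-++⁻ (map (x ∷_) (descents y m)) mem
  ...   | inj₂ mem′ = map₂ (map₂ (map₁ there)) (descentsVia-second x m ys mem′)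
  ...   | inj₁ mem′ with ∈-map⁻ (x ∷_) mem′
  ...     | ws , ws∈ , refl with IsWalk-head (proj₁ (descents-sound y m ws∈))
  ...       | rest , refl = y , rest , here refl , refl

  descents-unique : ∀ x m → Unique (descents x m)
  descentsVia-unique : ∀ x m ys → Unique ys → Unique (descentsVia x m ys)
  descents-unique x zero with h x ≡ᵇ 0
  ... | true  = [] ∷ []
  ... | false = []
  descents-unique x (suc m) = descentsVia-unique x m (nbrs x) (nbrs-unique x)
  descentsVia-unique x m [] _ = []
  descentsVia-unique x m (y ∷ ys) (y∉ys ∷ ys!) with h y ≡ᵇ m
  ... | false = descentsVia-unique x m ys ys!
  ... | true  = ++⁺ (map⁺ ∷-injectiveʳ (descents-unique y m)) (descentsVia-unique x m ys ys!) disjoint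
    where
    disjoint : ∀ {ws} → ¬ (ws ∈ map (x ∷_) (descents y m) × ws ∈ descentsVia x m ys)
    disjoint (mem , mem′) with ∈-map⁻ (x ∷_) mem | descentsVia-second x m ys mem′
    ... | ws , ws∈ , refl | z , _ , z∈ys , eq with IsWalk-head (proj₁ (descents-sound y m ws∈))
    ...   | _ , refl = All.lookup y∉ys z∈ys (∷-injectiveˡ (∷-injectiveʳ eq))

  length-descentsVia : ∀ f x m ys → (∀ y → h y ≡ m → length (descents y m) ≡ f y) →
    length (descentsVia x m ys) ≡ sumAtLevel f m ys
  length-descentsVia f x m [] _ = refl
  length-descentsVia f x m (y ∷ ys) ih
    rewrite length-++ (if h y ≡ᵇ m then map (x ∷_) (descents y m) else []) {descentsVia x m ys}
    with h y ≡ᵇ m in hy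
  ... | false = length-descentsVia f x m ys ih
  ... | true  = cong₂ _+_ (trans (length-map (x ∷_) (descents y m)) (ih y (≡ᵇ≡true⇒≡ hy)))
                          (length-descentsVia f x m ys ih)

  module _ (f : V n → ℕ) (f-target : f target ≡ 1)
           (f-recurrence : ∀ x m → h x ≡ suc m → sumAtLevel f m (nbrs x) ≡ f x) where

    length-descents : ∀ m x → h x ≡ m → length (descents x m) ≡ f x
    length-descents zero x hx rewrite hx | h≡0⇒target hx = sym f-target
    length-descents (suc m) x hx =
      trans (length-descentsVia f x m (nbrs x) (length-descents m)) (f-recurrence x m hx)

    -- Since descents are walks of the least possible length h s + 1, once one exists they are
    -- exactly the geodesics.
    σ-by-recurrence : ∀ s → 1 ≤ f s → σ_,_≡_in-GP2_ s target (f s)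
    σ-by-recurrence s 1≤fs =
      descents s (h s) , descents-unique s (h s) , All.tabulate geodesic , complete ,
      length-descents (h s) s refl
      where
      geodesic : ∀ {ws} → ws ∈ descents s (h s) → IsGeodesic n s target ws
      geodesic mem with descents-sound s (h s) mem
      ... | walk , len = walk , λ _ walk′ → subst (_≤ _) (sym len) (h<length walk′)
      member : ∀ {L : List Walk} → 1 ≤ length L → ∃ (_∈ L)
      member {_ ∷ _} _ = _ , here refl
      complete : ∀ ws → IsGeodesic n s target ws → ws ∈ descents s (h s)
      complete ws (walk , minimal) with member (subst (1 ≤_) (sym (length-descents (h s) s refl)) 1≤fs)
      ... | w₀ , w₀∈ with descents-sound s (h s) w₀∈
      ...   | walk₀ , len₀ = descents-complete s (h s) walk
                (≤-antisym (subst (length ws ≤_) len₀ (minimal w₀ walk₀)) (h<length walk)) refl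

SameUnorderedPair : ℕ × ℕ → ℕ × ℕ → Set
SameUnorderedPair (a , b) (x , y) = (a ≡ x × b ≡ y) ⊎ (a ≡ y × b ≡ x)

-- The shape of sumAtLevel over a neighbour list of length three.
sum-over-pair : ∀ (f : ℕ → ℕ) {p q x y} c → SameUnorderedPair (p , q) (x , y) →
  f p + (f q + (c + 0)) ≡ f x + f y + c
sum-over-pair f {x = x} {y} c (inj₁ (refl , refl)) =
  trans (cong (λ z → f x + (f y + z)) (+-identityʳ c)) (sym (+-assoc (f x) (f y) c))
sum-over-pair f {x = x} {y} c (inj₂ (refl , refl)) =
  trans (sum-over-pair f c (inj₁ (refl , refl))) (cong (_+ c) (+-comm (f y) (f x)))

module Cyclic (k : ℕ) where

  N : ℕ
  N = suc (2 * k)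

  N≡ : N ≡ suc (k + k)
  N≡ = cong (λ z → suc (k + z)) (+-identityʳ k)

  ‖_‖ : ℕ → ℕ
  ‖ o ‖ = o ⊓ (N ∸ o)

  +<N : ∀ {a b} → a ≤ k → b ≤ k → a + b < N
  +<N {a} {b} a≤k b≤k = subst (a + b <_) (sym N≡) (s≤s (+-mono-≤ a≤k b≤k))

  k<N : k < N
  k<N = s≤s (m≤m+n k (k + 0))

  ‖‖-small : ∀ {o} → o ≤ k → ‖ o ‖ ≡ o
  ‖‖-small {o} o≤k = m≤n⇒m⊓n≡m (m+n≤o⇒m≤o∸n o (<⇒≤ (+<N o≤k o≤k)))

  ‖‖-large : ∀ {o} → k < o → ‖ o ‖ ≡ N ∸ o
  ‖‖-large {o} k<o =
    m≥n⇒m⊓n≡n (m≤n+o⇒m∸n≤o N o (subst (_≤ o + o) (sym N≡) (+-mono-≤ k<o (<⇒≤ k<o))))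

  ‖‖≤k : ∀ o → ‖ o ‖ ≤ k
  ‖‖≤k o with o ≤? k
  ... | yes o≤k = ≤-trans (m⊓n≤m o _) o≤k
  ... | no o≰k  =
    ≤-trans (m⊓n≤n o _) (m≤n+o⇒m∸n≤o N o (subst (_≤ o + k) (sym N≡) (+-monoˡ-≤ k (≰⇒> o≰k))))

  ‖‖-complement : ∀ {a b} → a + b ≡ N → ‖ a ‖ ≡ ‖ b ‖
  ‖‖-complement {a} {b} a+b≡N = begin
    a ⊓ (N ∸ a) ≡⟨ cong (λ z → a ⊓ (z ∸ a)) (sym a+b≡N) ⟩
    a ⊓ (a + b ∸ a) ≡⟨ cong (a ⊓_) (m+n∸m≡n a b) ⟩
    a ⊓ b ≡⟨ ⊓-comm a b ⟩
    b ⊓ a ≡⟨ cong (b ⊓_) (sym (m+n∸n≡m a b)) ⟩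
    b ⊓ (a + b ∸ b) ≡⟨ cong (λ z → b ⊓ (z ∸ b)) a+b≡N ⟩
    b ⊓ (N ∸ b) ∎
    where open ≡-Reasoning

  ‖‖≡0⇒≡0 : ∀ {o} → o < N → ‖ o ‖ ≡ 0 → o ≡ 0
  ‖‖≡0⇒≡0 {o} o<N ‖o‖≡0 with o ≤? k
  ... | yes o≤k = trans (sym (‖‖-small o≤k)) ‖o‖≡0
  ... | no o≰k  = ⊥-elim (<⇒≢ (m<n⇒0<n∸m o<N) (sym (trans (sym (‖‖-large (≰⇒> o≰k))) ‖o‖≡0)))

  %-cases : ∀ x d → x < N → d ≤ N → (x + d) % N ≡ x + d ⊎ (x + d) % N + N ≡ x + d
  %-cases x d x<N d≤N with x + d <? N
  ... | yes x+d<N = inj₁ (m<n⇒m%n≡m x+d<N)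
  ... | no x+d≮N = inj₂ (begin
      (x + d) % N + N ≡⟨ cong (λ z → z % N + N) (sym x+d≡r+N) ⟩
      (r + N) % N + N ≡⟨ cong (_+ N) ([m+n]%n≡m%n r N) ⟩
      r % N + N       ≡⟨ cong (_+ N) (m<n⇒m%n≡m r<N) ⟩
      r + N           ≡⟨ x+d≡r+N ⟩
      x + d           ∎)
    where
    open ≡-Reasoning
    r = x + d ∸ N
    x+d≡r+N : r + N ≡ x + d
    x+d≡r+N = m∸n+n≡m (≮⇒≥ x+d≮N)
    r<N : r < N
    r<N = +-cancelʳ-< N r N (subst (_< N + N) (sym x+d≡r+N) (+-mono-<-≤ x<N d≤N))

  %-absorbˡ : ∀ x c → (x % N + c) % N ≡ (x + c) % N
  %-absorbˡ x c = begin
    (x % N + c) % N           ≡⟨ %-distribˡ-+ (x % N) c N ⟩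
    (x % N % N + c % N) % N   ≡⟨ cong (λ z → (z + c % N) % N) (m%n%n≡m%n x N) ⟩
    (x % N + c % N) % N       ≡⟨ %-distribˡ-+ x c N ⟨
    (x + c) % N               ∎
    where open ≡-Reasoning

  %-shift-back : ∀ x d e → x < N → d + e ≡ N → ((x + d) % N + e) % N ≡ x
  %-shift-back x d e x<N d+e≡N = begin
    ((x + d) % N + e) % N ≡⟨ %-absorbˡ (x + d) e ⟩
    (x + d + e) % N       ≡⟨ cong (_% N) (trans (+-assoc x d e) (cong (x +_) d+e≡N)) ⟩
    (x + N) % N           ≡⟨ [m+n]%n≡m%n x N ⟩
    x % N                 ≡⟨ m<n⇒m%n≡m x<N ⟩
    x                     ∎
    where open ≡-Reasoning

  %-shift-comm : ∀ a c d → ((a + d) % N + c) % N ≡ ((a + c) % N + d) % N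
  %-shift-comm a c d = begin
    ((a + d) % N + c) % N ≡⟨ %-absorbˡ (a + d) c ⟩
    (a + d + c) % N       ≡⟨ cong (_% N) (+-assoc a d c) ⟩
    (a + (d + c)) % N     ≡⟨ cong (λ z → (a + z) % N) (+-comm d c) ⟩
    (a + (c + d)) % N     ≡⟨ cong (_% N) (+-assoc a c d) ⟨
    (a + c + d) % N       ≡⟨ %-absorbˡ (a + c) d ⟨
    ((a + c) % N + d) % N ∎
    where open ≡-Reasoning

  %-shift-≢ : ∀ x e → x < N → 0 < e → e < N → (x + e) % N ≢ x
  %-shift-≢ x e x<N 0<e e<N eq with %-cases x e x<N (<⇒≤ e<N)
  ... | inj₁ eq′ = <⇒≢ 0<e (sym (+-cancelˡ-≡ x e 0 (trans (trans (sym eq′) eq) (sym (+-identityʳ x)))))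
  ... | inj₂ eq′ = <⇒≢ e<N (sym (+-cancelˡ-≡ x N e (trans (cong (_+ N) (sym eq)) eq′)))

  ‖‖-negate : ∀ x y → (x + y) % N ≡ 0 → ‖ x % N ‖ ≡ ‖ y % N ‖
  ‖‖-negate x y x+y≡0 with %-cases (x % N) (y % N) (m%n<n x N) (m%n≤n y N)
  ... | inj₁ eq = trans (cong ‖_‖ (m+n≡0⇒m≡0 _ p+q≡0)) (cong ‖_‖ (sym (m+n≡0⇒n≡0 _ p+q≡0)))
    where p+q≡0 = trans (sym eq) (trans (sym (%-distribˡ-+ x y N)) x+y≡0)
  ... | inj₂ eq = ‖‖-complement (trans (sym eq) (cong (_+ N) (trans (sym (%-distribˡ-+ x y N)) x+y≡0)))

  ∣-∣≤k : ∀ {a b} → a ≤ k → b ≤ k → ∣ a - b ∣ ≤ k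
  ∣-∣≤k {a} {b} a≤k b≤k = ≤-trans (∣m-n∣≤m⊔n a b) (⊔-lub a≤k b≤k)

  ‖‖-%-small-sum : ∀ {a b} → a ≤ k → b ≤ k → ‖ (a + b) % N ‖ ≡ ‖ a + b ‖
  ‖‖-%-small-sum a≤k b≤k = cong ‖_‖ (m<n⇒m%n≡m (+<N a≤k b≤k))

  ‖‖-difference : ∀ o d → o < N → d ≤ N → ∣ o - d ∣ ≤ k → ‖ (o + (N ∸ d)) % N ‖ ≡ ∣ o - d ∣
  ‖‖-difference o d o<N d≤N ∣o-d∣≤k with d ≤? o
  ... | yes d≤o = begin
      ‖ (o + (N ∸ d)) % N ‖ ≡⟨ cong (λ z → ‖ z % N ‖) o+[N∸d]≡[o∸d]+N ⟩
      ‖ (o ∸ d + N) % N ‖   ≡⟨ cong ‖_‖ ([m+n]%n≡m%n (o ∸ d) N) ⟩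
      ‖ (o ∸ d) % N ‖       ≡⟨ cong ‖_‖ (m<n⇒m%n≡m (≤-<-trans o∸d≤k k<N)) ⟩
      ‖ o ∸ d ‖             ≡⟨ ‖‖-small o∸d≤k ⟩
      o ∸ d                 ≡⟨ m≤n⇒∣n-m∣≡n∸m d≤o ⟨
      ∣ o - d ∣             ∎
    where
    open ≡-Reasoning
    o∸d≤k = subst (_≤ k) (m≤n⇒∣n-m∣≡n∸m d≤o) ∣o-d∣≤k
    o+[N∸d]≡[o∸d]+N : o + (N ∸ d) ≡ o ∸ d + N
    o+[N∸d]≡[o∸d]+N = begin
      o + (N ∸ d)           ≡⟨ cong (_+ (N ∸ d)) (m∸n+n≡m d≤o) ⟨
      o ∸ d + d + (N ∸ d)   ≡⟨ +-assoc (o ∸ d) d (N ∸ d) ⟩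
      o ∸ d + (d + (N ∸ d)) ≡⟨ cong (o ∸ d +_) (m+[n∸m]≡n d≤N) ⟩
      o ∸ d + N             ∎
  ... | no d≰o = begin
      ‖ (o + (N ∸ d)) % N ‖ ≡⟨ cong ‖_‖ (m<n⇒m%n≡m o+[N∸d]<N) ⟩
      ‖ o + (N ∸ d) ‖       ≡⟨ ‖‖-complement sum≡N ⟩
      ‖ d ∸ o ‖             ≡⟨ ‖‖-small d∸o≤k ⟩
      d ∸ o                 ≡⟨ m≤n⇒∣m-n∣≡n∸m o≤d ⟨
      ∣ o - d ∣             ∎
    where
    open ≡-Reasoning
    o<d = ≰⇒> d≰o
    o≤d = <⇒≤ o<d
    d∸o≤k = subst (_≤ k) (m≤n⇒∣m-n∣≡n∸m o≤d) ∣o-d∣≤k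
    sum≡N : o + (N ∸ d) + (d ∸ o) ≡ N
    sum≡N = begin
      o + (N ∸ d) + (d ∸ o)   ≡⟨ +-assoc o (N ∸ d) (d ∸ o) ⟩
      o + ((N ∸ d) + (d ∸ o)) ≡⟨ cong (o +_) (+-comm (N ∸ d) (d ∸ o)) ⟩
      o + ((d ∸ o) + (N ∸ d)) ≡⟨ +-assoc o (d ∸ o) (N ∸ d) ⟨
      o + (d ∸ o) + (N ∸ d)   ≡⟨ cong (_+ (N ∸ d)) (m+[n∸m]≡n o≤d) ⟩
      d + (N ∸ d)             ≡⟨ m+[n∸m]≡n d≤N ⟩
      N                       ∎
    o+[N∸d]<N : o + (N ∸ d) < N
    o+[N∸d]<N = subst (o + (N ∸ d) <_) sum≡N (m<m+n _ (m<n⇒0<n∸m o<d))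

  %-two-complements : ∀ a b c e → a + b ≡ N → c + e ≡ N → (a + c + (b + e)) % N ≡ 0
  %-two-complements a b c e a+b≡N c+e≡N = begin
    (a + c + (b + e)) % N ≡⟨ cong (_% N) (+-interchange a c b e) ⟩
    (a + b + (c + e)) % N ≡⟨ cong₂ (λ x y → (x + y) % N) a+b≡N c+e≡N ⟩
    (N + N) % N           ≡⟨ [m+n]%n≡m%n N N ⟩
    N % N                 ≡⟨ n%n≡0 N ⟩
    0                     ∎
    where open ≡-Reasoning

  ‖‖-shift : ∀ o d → o < N → d ≤ k →
    SameUnorderedPair (‖ (o + d) % N ‖ , ‖ (o + (N ∸ d)) % N ‖) (‖ ‖ o ‖ + d ‖ , ∣ ‖ o ‖ - d ∣)
  ‖‖-shift o d o<N d≤k with o ≤? k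
  ... | yes o≤k rewrite ‖‖-small o≤k =
    inj₁ (‖‖-%-small-sum o≤k d≤k , ‖‖-difference o d o<N d≤N (∣-∣≤k o≤k d≤k))
    where d≤N = ≤-trans d≤k (<⇒≤ k<N)
  ... | no o≰k rewrite ‖‖-large (≰⇒> o≰k) =
    inj₂ ( trans (‖‖-negate (o + d) (t + (N ∸ d)) (%-two-complements o t d (N ∸ d) o+t≡N (m+[n∸m]≡n d≤N)))
                 (‖‖-difference t d (≤-<-trans t≤k k<N) d≤N (∣-∣≤k t≤k d≤k))
         , trans (‖‖-negate (o + (N ∸ d)) (t + d) (%-two-complements o t (N ∸ d) d o+t≡N (m∸n+n≡m d≤N)))
                 (‖‖-%-small-sum t≤k d≤k))
    where
    t = N ∸ o
    d≤N = ≤-trans d≤k (<⇒≤ k<N)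
    t≤k : t ≤ k
    t≤k = subst (_≤ k) (‖‖-large (≰⇒> o≰k)) (‖‖≤k o)
    o+t≡N : o + t ≡ N
    o+t≡N = m+[n∸m]≡n (<⇒≤ o<N)

  +≤N : ∀ {a b} → a ≤ k → b ≤ suc k → a + b ≤ N
  +≤N {a} {b} a≤k b≤1+k = subst (a + b ≤_) (trans (+-suc k k) (sym N≡)) (+-mono-≤ a≤k b≤1+k)

  ≤‖+1‖ : ∀ {t} → t ≤ k → t ≤ ‖ t + 1 ‖
  ≤‖+1‖ {t} t≤k =
    ⊓-glb (m≤m+n t 1) (m+n≤o⇒m≤o∸n t (+≤N t≤k (subst (_≤ suc k) (+-comm 1 t) (s≤s t≤k))))

  ‖+2‖-cases : ∀ {t} → 1 ≤ k → t ≤ k → (t < k × t < ‖ t + 2 ‖) ⊎ (t ≡ k × suc ‖ t + 2 ‖ ≡ k)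
  ‖+2‖-cases {t} 1≤k t≤k with t <? k
  ... | yes t<k = inj₁ (t<k , ⊓-glb (m<m+n t (s≤s z≤n))
                                      (m+n≤o⇒m≤o∸n (suc t) (+≤N t<k (subst (_≤ suc k) (+-comm 2 t) (s≤s t<k)))))
  ... | no t≮k rewrite ≤-antisym t≤k (≮⇒≥ t≮k) = inj₂ (refl , (begin
      suc ‖ k + 2 ‖               ≡⟨ cong suc (‖‖-large (m<m+n k (s≤s z≤n))) ⟩
      suc (N ∸ (k + 2))           ≡⟨ cong₂ (λ x y → suc (x ∸ y)) N≡ (+-comm k 2) ⟩
      suc (k + k ∸ suc k)         ≡⟨ suc[n+n∸suc-n] 1≤k ⟩
      k                           ∎))
    where
    open ≡-Reasoning
    suc[n+n∸suc-n] : ∀ {n} → 1 ≤ n → suc (n + n ∸ suc n) ≡ n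
    suc[n+n∸suc-n] {suc n} _ = cong suc (m+n∸n≡m n (suc n))

  ≤‖+‖+ : ∀ {t d} → t ≤ k → d ≤ k → t ≤ ‖ t + d ‖ + d
  ≤‖+‖+ {t} {d} t≤k d≤k = subst (t ≤_) (sym (+-distribʳ-⊓ d (t + d) (N ∸ (t + d))))
    (⊓-glb (≤-trans (m≤m+n t d) (m≤m+n (t + d) d)) (subst (t ≤_) (sym N∸[t+d]+d≡N∸t) t≤N∸t))
    where
    t≤N∸t : t ≤ N ∸ t
    t≤N∸t = m+n≤o⇒m≤o∸n t (<⇒≤ (+<N t≤k t≤k))
    N∸[t+d]+d≡N∸t : N ∸ (t + d) + d ≡ N ∸ t
    N∸[t+d]+d≡N∸t = trans (cong (_+ d) (sym (∸-+-assoc N t d)))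
                          (m∸n+n≡m (m+n≤o⇒m≤o∸n d (<⇒≤ (subst (_< N) (+-comm t d) (+<N t≤k d≤k)))))

  ‖‖-%-lipschitz : ∀ o d → o < N → d ≤ k →
    ‖ (o + d) % N ‖ ≤ ‖ o ‖ + d × ‖ o ‖ ≤ ‖ (o + d) % N ‖ + d
  ‖‖-%-lipschitz o d o<N d≤k with ‖‖-shift o d o<N d≤k
  ... | inj₁ (eq , _) rewrite eq = m⊓n≤m _ _ , ≤‖+‖+ (‖‖≤k o) d≤k
  ... | inj₂ (eq , _) rewrite eq =
    ≤-trans (∣m-n∣≤m⊔n ‖ o ‖ d) (m⊔n≤m+n ‖ o ‖ d) , m≤∣m-n∣+n ‖ o ‖ d

mono-from-suc : (f : ℕ → ℕ) → (∀ t → f t ≤ f (suc t)) → ∀ {a b} → a ≤ b → f a ≤ f b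
mono-from-suc f f-suc a≤b = go (≤⇒≤′ a≤b)
  where
  go : ∀ {b} → _ ≤′ b → f _ ≤ f b
  go ≤′-refl       = ≤-refl
  go (≤′-step a≤b) = ≤-trans (go a≤b) (f-suc _)

-- Distances from u_j to the outer and inner vertex at cyclic position t ≤ k: walk along the
-- outer cycle, or take the spoke and move two positions per inner edge.
outerDist : ℕ → ℕ
outerDist 0 = 0
outerDist 1 = 1
outerDist 2 = 2
outerDist 3 = 3
outerDist t@(suc (suc (suc (suc _)))) = 2 + ⌈ t /2⌉

innerDist : ℕ → ℕ
innerDist t = suc ⌈ t /2⌉

⌈1+n/2⌉≤1+⌈n/2⌉ : ∀ n → ⌈ suc n /2⌉ ≤ suc ⌈ n /2⌉
⌈1+n/2⌉≤1+⌈n/2⌉ zero          = ≤-refl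
⌈1+n/2⌉≤1+⌈n/2⌉ (suc zero)    = s≤s z≤n
⌈1+n/2⌉≤1+⌈n/2⌉ (suc (suc n)) = s≤s (⌈1+n/2⌉≤1+⌈n/2⌉ n)

outerDist-suc : ∀ t → outerDist t ≤ outerDist (suc t) × outerDist (suc t) ≤ suc (outerDist t)
outerDist-suc 0 = z≤n , ≤-refl
outerDist-suc 1 = s≤s z≤n , ≤-refl
outerDist-suc 2 = s≤s (s≤s z≤n) , ≤-refl
outerDist-suc 3 = s≤s (s≤s (s≤s z≤n)) , ≤-refl
outerDist-suc t@(suc (suc (suc (suc _)))) =
  s≤s (s≤s (⌈n/2⌉-mono (n≤1+n t))) , s≤s (s≤s (⌈1+n/2⌉≤1+⌈n/2⌉ t))

outerDist-mono : ∀ {a b} → a ≤ b → outerDist a ≤ outerDist b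
outerDist-mono = mono-from-suc outerDist (proj₁ ∘ outerDist-suc)

innerDist-mono : ∀ {a b} → a ≤ b → innerDist a ≤ innerDist b
innerDist-mono a≤b = s≤s (⌈n/2⌉-mono a≤b)

outerDist-lipschitz : ∀ {x y} → x ≤ y + 1 → outerDist x ≤ suc (outerDist y)
outerDist-lipschitz {x} {y} x≤y+1 =
  ≤-trans (outerDist-mono (subst (x ≤_) (+-comm y 1) x≤y+1)) (proj₂ (outerDist-suc y))

innerDist-lipschitz : ∀ {x y} → x ≤ y + 2 → innerDist x ≤ suc (innerDist y)
innerDist-lipschitz {x} {y} x≤y+2 = innerDist-mono (subst (x ≤_) (+-comm y 2) x≤y+2)

outerDist≤1+innerDist : ∀ t → outerDist t ≤ suc (innerDist t)
outerDist≤1+innerDist 0 = z≤n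
outerDist≤1+innerDist 1 = s≤s z≤n
outerDist≤1+innerDist 2 = s≤s (s≤s z≤n)
outerDist≤1+innerDist 3 = s≤s (s≤s (s≤s z≤n))
outerDist≤1+innerDist (suc (suc (suc (suc _)))) = ≤-refl

innerDist≤1+outerDist : ∀ t → innerDist t ≤ suc (outerDist t)
innerDist≤1+outerDist 0 = ≤-refl
innerDist≤1+outerDist 1 = ≤-refl
innerDist≤1+outerDist 2 = s≤s (s≤s z≤n)
innerDist≤1+outerDist 3 = s≤s (s≤s (s≤s z≤n))
innerDist≤1+outerDist (suc (suc (suc (suc _)))) = ≤-trans (n≤1+n _) (n≤1+n _)

innerDist≤outerDist : ∀ t → 2 ≤ t → innerDist t ≤ outerDist t
innerDist≤outerDist 1 (s≤s ())
innerDist≤outerDist 2 _ = ≤-refl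
innerDist≤outerDist 3 _ = ≤-refl
innerDist≤outerDist (suc (suc (suc (suc _)))) _ = n≤1+n _

outerDist≡0⇒≡0 : ∀ {t} → outerDist t ≡ 0 → t ≡ 0
outerDist≡0⇒≡0 {0} _ = refl
outerDist≡0⇒≡0 {1} ()
outerDist≡0⇒≡0 {2} ()
outerDist≡0⇒≡0 {3} ()
outerDist≡0⇒≡0 {suc (suc (suc (suc _)))} ()

⌈n/2⌉-rises-at-even : ∀ t → (suc ⌈ t /2⌉ ≡ᵇ ⌈ suc t /2⌉) ≡ (t % 2 ≡ᵇ 0)
⌈n/2⌉-rises-at-even 0 = refl
⌈n/2⌉-rises-at-even 1 = refl
⌈n/2⌉-rises-at-even (suc (suc t)) = ⌈n/2⌉-rises-at-even t

⌈n/2⌉-stalls-at-odd : ∀ t → (⌈ suc t /2⌉ ≡ᵇ ⌈ t /2⌉) ≡ (t % 2 ≡ᵇ 1)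
⌈n/2⌉-stalls-at-odd 0 = refl
⌈n/2⌉-stalls-at-odd 1 = refl
⌈n/2⌉-stalls-at-odd (suc (suc t)) = ⌈n/2⌉-stalls-at-odd t

[1+n]%2≡1⇒n%2≡0 : ∀ n → suc n % 2 ≡ 1 → n % 2 ≡ 0
[1+n]%2≡1⇒n%2≡0 0 _ = refl
[1+n]%2≡1⇒n%2≡0 (suc (suc n)) eq = [1+n]%2≡1⇒n%2≡0 n eq

[odd]+1≡1+n%2 : ∀ n → (if n % 2 ≡ᵇ 1 then 1 else 0) + 1 ≡ suc (n % 2)
[odd]+1≡1+n%2 0 = refl
[odd]+1≡1+n%2 1 = refl
[odd]+1≡1+n%2 (suc (suc n)) = [odd]+1≡1+n%2 n

module Counts (k : ℕ) (2≤k : 2 ≤ k) where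
  open Cyclic k

  1≤k : 1 ≤ k
  1≤k = ≤-trans (s≤s z≤n) 2≤k

  -- Numbers of geodesics from the inner and the outer vertex at cyclic position t ≤ k to u_j.
  -- For odd k the inner vertex at position k also reaches v_j the other way round the inner cycle.
  innerCount : ℕ → ℕ
  innerCount t = if t ≡ᵇ k then suc (k % 2) else 1

  -- From position t + 1 ≥ 5 a geodesic takes the spoke or, when t is even, the outer edge.
  outerCount : ℕ → ℕ
  outerCount 0 = 1
  outerCount 1 = 1
  outerCount 2 = 1
  outerCount 3 = 1
  outerCount 4 = 2
  outerCount (suc t@(suc (suc (suc (suc _))))) =
    (if t % 2 ≡ᵇ 0 then outerCount t else 0) + innerCount (suc t)

  outerAt innerAt : ℕ → ℕ → ℕ
  outerAt m t = if outerDist t ≡ᵇ m then outerCount t else 0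
  innerAt m t = if innerDist t ≡ᵇ m then innerCount t else 0

  outerAt-≢ : ∀ {m t} → outerDist t ≢ m → outerAt m t ≡ 0
  outerAt-≢ ne rewrite ≢⇒≡ᵇ≡false ne = refl

  innerAt-≢ : ∀ {m t} → innerDist t ≢ m → innerAt m t ≡ 0
  innerAt-≢ ne rewrite ≢⇒≡ᵇ≡false ne = refl

  innerCount-≢ : ∀ {t} → t ≢ k → innerCount t ≡ 1
  innerCount-≢ t≢k rewrite ≢⇒≡ᵇ≡false t≢k = refl

  innerCount-at-k : ∀ {t} → t ≡ k → innerCount t ≡ suc (t % 2)
  innerCount-at-k refl rewrite ≡⇒≡ᵇ≡true {k} refl = refl

  innerCount-even : ∀ t → t % 2 ≡ 0 → innerCount t ≡ 1
  innerCount-even t t%2≡0 with t ≟ k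
  ... | yes t≡k = trans (innerCount-at-k t≡k) (cong suc t%2≡0)
  ... | no t≢k   = innerCount-≢ t≢k

  outer-recurrence : ∀ t m → t ≤ k → outerDist t ≡ suc m →
    outerAt m ‖ t + 1 ‖ + outerAt m ∣ t - 1 ∣ + innerAt m t ≡ outerCount t
  outer-recurrence t m t≤k eq
    rewrite outerAt-≢ {m} {‖ t + 1 ‖}
              (>⇒≢ (subst (_≤ outerDist ‖ t + 1 ‖) eq (outerDist-mono (≤‖+1‖ t≤k)))) =
    towards t m eq
    where
    towards : ∀ t m → outerDist t ≡ suc m → outerAt m ∣ t - 1 ∣ + innerAt m t ≡ outerCount t
    towards 1 .0 refl = refl
    towards 2 .1 refl = refl
    towards 3 .2 refl = refl
    towards 4 .3 refl = cong suc (innerCount-even 4 refl)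
    towards (suc (suc (suc (suc (suc s))))) m refl
      rewrite ⌈n/2⌉-rises-at-even s | ≡⇒≡ᵇ≡true {⌈ suc s /2⌉} refl = refl

  inner-recurrence : ∀ t m → t ≤ k → innerDist t ≡ suc m →
    innerAt m ‖ t + 2 ‖ + innerAt m ∣ t - 2 ∣ + outerAt m t ≡ innerCount t
  inner-recurrence t m t≤k eq with ‖+2‖-cases 1≤k t≤k
  ... | inj₁ (t<k , t<‖t+2‖)
    rewrite innerAt-≢ {m} {‖ t + 2 ‖}
              (>⇒≢ (subst (_≤ innerDist ‖ t + 2 ‖) eq (innerDist-mono (<⇒≤ t<‖t+2‖)))) =
    below t m t<k eq
    where
    below : ∀ t m → t < k → innerDist t ≡ suc m → innerAt m ∣ t - 2 ∣ + outerAt m t ≡ innerCount t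
    below 0 .0 0<k refl = sym (innerCount-≢ (<⇒≢ 0<k))
    below 1 .1 1<k refl = sym (innerCount-≢ (<⇒≢ 1<k))
    below (suc (suc s)) .(suc ⌈ s /2⌉) 2+s<k refl
      rewrite ∣-∣-identityʳ s | ≡⇒≡ᵇ≡true {innerDist s} refl
            | outerAt-≢ {suc ⌈ s /2⌉} {2 + s} (>⇒≢ (innerDist≤outerDist (2 + s) (s≤s (s≤s z≤n))))
            | innerCount-≢ (<⇒≢ (≤-trans (m≤n+m (suc s) 2) 2+s<k))
            | innerCount-≢ (<⇒≢ 2+s<k) = refl
  ... | inj₂ (t≡k , 1+‖t+2‖≡k) = antipode t m t≡k eq (trans 1+‖t+2‖≡k (sym t≡k))
    where
    antipode : ∀ t m → t ≡ k → innerDist t ≡ suc m → suc ‖ t + 2 ‖ ≡ t →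
      innerAt m ‖ t + 2 ‖ + innerAt m ∣ t - 2 ∣ + outerAt m t ≡ innerCount t
    antipode 0 _ 0≡k = ⊥-elim (<⇒≢ (≤-trans (s≤s z≤n) 2≤k) 0≡k)
    antipode 1 _ 1≡k = ⊥-elim (<⇒≢ 2≤k 1≡k)
    antipode (suc (suc s)) .(suc ⌈ s /2⌉) 2+s≡k refl 1+‖t+2‖≡t
      rewrite suc-injective 1+‖t+2‖≡t | ∣-∣-identityʳ s | ⌈n/2⌉-stalls-at-odd s
            | ≡⇒≡ᵇ≡true {innerDist s} refl
            | outerAt-≢ {suc ⌈ s /2⌉} {2 + s} (>⇒≢ (innerDist≤outerDist (2 + s) (s≤s (s≤s z≤n))))
            | innerCount-≢ (<⇒≢ (subst (suc s <_) 2+s≡k ≤-refl))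
            | innerCount-≢ (<⇒≢ (subst (s <_) 2+s≡k (n≤1+n (suc s))))
            | sym 2+s≡k | ≡⇒≡ᵇ≡true {2 + s} refl =
      trans (+-identityʳ _) ([odd]+1≡1+n%2 s)

  innerCount≥1 : ∀ t → 1 ≤ innerCount t
  innerCount≥1 t with t ≡ᵇ k
  ... | true  = s≤s z≤n
  ... | false = ≤-refl

  outerCount≥1 : ∀ t → 1 ≤ outerCount t
  outerCount≥1 0 = ≤-refl
  outerCount≥1 1 = ≤-refl
  outerCount≥1 2 = ≤-refl
  outerCount≥1 3 = ≤-refl
  outerCount≥1 4 = s≤s z≤n
  outerCount≥1 (suc t@(suc (suc (suc (suc _))))) = ≤-trans (innerCount≥1 (suc t)) (m≤n+m _ _)

  outerCount-even : ∀ r → 6 ≤ r → r % 2 ≡ 0 → outerCount r ≡ 1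
  outerCount-even (suc t) (s≤s (s≤s (s≤s (s≤s (s≤s (s≤s _)))))) r%2≡0
    rewrite %-pred-≡0 {t} {2} r%2≡0 = innerCount-even (suc t) r%2≡0

  outerCount-odd : ∀ r → 7 ≤ r → r % 2 ≡ 1 → outerCount r ≡ suc (innerCount r)
  outerCount-odd (suc t) (s≤s 6≤t@(s≤s (s≤s (s≤s (s≤s (s≤s (s≤s _))))))) r%2≡1
    = cong (_+ innerCount (suc t))
        (trans (cong (λ b → if b ≡ᵇ 0 then outerCount t else 0) t%2≡0) (outerCount-even t 6≤t t%2≡0))
    where t%2≡0 = [1+n]%2≡1⇒n%2≡0 t r%2≡1

module PetersenGP (k : ℕ) (2≤k : 2 ≤ k) (j : Fin (suc (2 * k))) where
  open Cyclic k
  open Counts k 2≤k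

  offset : Fin N → ℕ
  offset a = (toℕ a + (N ∸ toℕ j)) % N

  offset<N : ∀ a → offset a < N
  offset<N a = m%n<n (toℕ a + (N ∸ toℕ j)) N

  pos : Fin N → ℕ
  pos a = ‖ offset a ‖

  _+ᶠ_ : Fin N → ℕ → Fin N
  a +ᶠ d = fromℕ< (m%n<n (toℕ a + d) N)

  toℕ-+ᶠ : ∀ a d → toℕ (a +ᶠ d) ≡ (toℕ a + d) % N
  toℕ-+ᶠ a d = toℕ-fromℕ< _

  +ᶠ-back : ∀ a d → d ≤ N → toℕ a ≡ (toℕ (a +ᶠ (N ∸ d)) + d) % N
  +ᶠ-back a d d≤N = sym (trans (cong (λ z → (z + d) % N) (toℕ-+ᶠ a (N ∸ d)))
                               (%-shift-back (toℕ a) (N ∸ d) d (toℕ<n a) (m∸n+n≡m d≤N)))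

  ≡+ᶠ : ∀ {a b} d → toℕ b ≡ (toℕ a + d) % N → b ≡ a +ᶠ d
  ≡+ᶠ {a} d b≡a+d = toℕ-injective (trans b≡a+d (sym (toℕ-+ᶠ a d)))

  ≡+ᶠ-back : ∀ {a b} d → d ≤ N → toℕ a ≡ (toℕ b + d) % N → b ≡ a +ᶠ (N ∸ d)
  ≡+ᶠ-back {a} {b} d d≤N a≡b+d = toℕ-injective (sym (begin
    toℕ (a +ᶠ (N ∸ d))            ≡⟨ toℕ-+ᶠ a (N ∸ d) ⟩
    (toℕ a + (N ∸ d)) % N         ≡⟨ cong (λ z → (z + (N ∸ d)) % N) a≡b+d ⟩
    ((toℕ b + d) % N + (N ∸ d)) % N ≡⟨ %-shift-back (toℕ b) d (N ∸ d) (toℕ<n b) (m+[n∸m]≡n d≤N) ⟩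
    toℕ b                         ∎))
    where open ≡-Reasoning

  +ᶠ-≢ : ∀ a d → 0 < d → d ≤ k → a +ᶠ d ≢ a +ᶠ (N ∸ d)
  +ᶠ-≢ a d 0<d d≤k eq =
    %-shift-≢ (toℕ a) (d + d) (toℕ<n a) (≤-trans 0<d (m≤m+n d d)) (+<N d≤k d≤k) (begin
      (toℕ a + (d + d)) % N                ≡⟨ cong (_% N) (+-assoc (toℕ a) d d) ⟨
      (toℕ a + d + d) % N                  ≡⟨ %-absorbˡ (toℕ a + d) d ⟨
      ((toℕ a + d) % N + d) % N            ≡⟨ cong (λ z → (z + d) % N) (sym (toℕ-+ᶠ a d)) ⟩
      (toℕ (a +ᶠ d) + d) % N               ≡⟨ cong (λ z → (toℕ z + d) % N) eq ⟩
      (toℕ (a +ᶠ (N ∸ d)) + d) % N         ≡⟨ +ᶠ-back a d (≤-trans d≤k (<⇒≤ k<N)) ⟨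
      toℕ a                                ∎)
    where open ≡-Reasoning

  offset-step : ∀ {a b} d → toℕ b ≡ (toℕ a + d) % N → offset b ≡ (offset a + d) % N
  offset-step {a} d b≡a+d =
    trans (cong (λ z → (z + (N ∸ toℕ j)) % N) b≡a+d) (%-shift-comm (toℕ a) (N ∸ toℕ j) d)

  pos-step : ∀ {a b} d → d ≤ k → toℕ b ≡ (toℕ a + d) % N → pos b ≤ pos a + d × pos a ≤ pos b + d
  pos-step {a} {b} d d≤k b≡a+d rewrite offset-step {a} {b} d b≡a+d =
    ‖‖-%-lipschitz (offset a) d (offset<N a) d≤k

  pos-shift : ∀ a d → d ≤ k →
    SameUnorderedPair (pos (a +ᶠ d) , pos (a +ᶠ (N ∸ d))) (‖ pos a + d ‖ , ∣ pos a - d ∣)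
  pos-shift a d d≤k
    rewrite offset-step {a} {a +ᶠ d} d (toℕ-+ᶠ a d)
          | offset-step {a} {a +ᶠ (N ∸ d)} (N ∸ d) (toℕ-+ᶠ a (N ∸ d)) =
    ‖‖-shift (offset a) d (offset<N a) d≤k

  pos≡0⇒≡j : ∀ {a} → pos a ≡ 0 → a ≡ j
  pos≡0⇒≡j {a} pos≡0 = toℕ-injective (begin
    toℕ a                                     ≡⟨ %-shift-back (toℕ a) (N ∸ toℕ j) (toℕ j) (toℕ<n a) N∸j+j≡N ⟨
    ((toℕ a + (N ∸ toℕ j)) % N + toℕ j) % N   ≡⟨ cong (λ z → (z + toℕ j) % N) (‖‖≡0⇒≡0 (offset<N a) pos≡0) ⟩
    toℕ j % N                                 ≡⟨ m<n⇒m%n≡m (toℕ<n j) ⟩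
    toℕ j                                     ∎)
    where
    open ≡-Reasoning
    N∸j+j≡N = m∸n+n≡m (<⇒≤ (toℕ<n j))

  pos-j : pos j ≡ 0
  pos-j = cong ‖_‖ (trans (cong (_% N) (m+[n∸m]≡n (<⇒≤ (toℕ<n j)))) (n%n≡0 N))

  pos≡∣-∣ : ∀ a → ∣ toℕ a - toℕ j ∣ ≤ k → pos a ≡ ∣ toℕ a - toℕ j ∣
  pos≡∣-∣ a = ‖‖-difference (toℕ a) (toℕ j) (toℕ<n a) (<⇒≤ (toℕ<n j))

  potential : V N → ℕ
  potential (u a) = outerDist (pos a)
  potential (v a) = innerDist (pos a)

  count : V N → ℕ
  count (u a) = outerCount (pos a)
  count (v a) = innerCount (pos a)

  nbrs : V N → List (V N)
  nbrs (u a) = u (a +ᶠ 1) ∷ u (a +ᶠ (N ∸ 1)) ∷ v a ∷ []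
  nbrs (v a) = v (a +ᶠ 2) ∷ v (a +ᶠ (N ∸ 2)) ∷ u a ∷ []

  1≤N : 1 ≤ N
  1≤N = s≤s z≤n

  2≤N : 2 ≤ N
  2≤N = ≤-trans 2≤k (<⇒≤ k<N)

  ∈nbrs⇒Adj : ∀ {x y} → y ∈ nbrs x → Adj N x y
  ∈nbrs⇒Adj {u a} (here refl)                 = outer⁺ (toℕ-+ᶠ a 1)
  ∈nbrs⇒Adj {u a} (there (here refl))         = outer⁻ (+ᶠ-back a 1 1≤N)
  ∈nbrs⇒Adj {u a} (there (there (here refl))) = spoke⁺
  ∈nbrs⇒Adj {v a} (here refl)                 = inner⁺ (toℕ-+ᶠ a 2)
  ∈nbrs⇒Adj {v a} (there (here refl))         = inner⁻ (+ᶠ-back a 2 2≤N)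
  ∈nbrs⇒Adj {v a} (there (there (here refl))) = spoke⁻

  Adj⇒∈nbrs : ∀ {x y} → Adj N x y → y ∈ nbrs x
  Adj⇒∈nbrs (outer⁺ {a} b≡a+1) = here (cong u (≡+ᶠ {a} 1 b≡a+1))
  Adj⇒∈nbrs (outer⁻ {a} {b} a≡b+1) = there (here (cong u (≡+ᶠ-back {a} {b} 1 1≤N a≡b+1)))
  Adj⇒∈nbrs spoke⁺          = there (there (here refl))
  Adj⇒∈nbrs (inner⁺ {a} b≡a+2) = here (cong v (≡+ᶠ {a} 2 b≡a+2))
  Adj⇒∈nbrs (inner⁻ {a} {b} a≡b+2) = there (here (cong v (≡+ᶠ-back {a} {b} 2 2≤N a≡b+2)))
  Adj⇒∈nbrs spoke⁻          = there (there (here refl))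

  u-injective : ∀ {a b : Fin N} → u a ≡ u b → a ≡ b
  u-injective refl = refl

  v-injective : ∀ {a b : Fin N} → v a ≡ v b → a ≡ b
  v-injective refl = refl

  nbrs-unique : ∀ x → Unique (nbrs x)
  nbrs-unique (u a) = (u≢ ∷ (λ ()) ∷ []) ∷ ((λ ()) ∷ []) ∷ [] ∷ []
    where
    u≢ : u (a +ᶠ 1) ≢ u (a +ᶠ (N ∸ 1))
    u≢ = +ᶠ-≢ a 1 (s≤s z≤n) 1≤k ∘ u-injective
  nbrs-unique (v a) = (v≢ ∷ (λ ()) ∷ []) ∷ ((λ ()) ∷ []) ∷ [] ∷ []
    where
    v≢ : v (a +ᶠ 2) ≢ v (a +ᶠ (N ∸ 2))
    v≢ = +ᶠ-≢ a 2 (s≤s z≤n) 2≤k ∘ v-injective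

  potential-lipschitz : ∀ {x y} → Adj N x y → potential x ≤ suc (potential y)
  potential-lipschitz (outer⁺ {a} {b} b≡a+1) = outerDist-lipschitz (proj₂ (pos-step {a} {b} 1 1≤k b≡a+1))
  potential-lipschitz (outer⁻ {a} {b} a≡b+1) = outerDist-lipschitz (proj₁ (pos-step {b} {a} 1 1≤k a≡b+1))
  potential-lipschitz (spoke⁺ {a})   = outerDist≤1+innerDist (pos a)
  potential-lipschitz (spoke⁻ {a})   = innerDist≤1+outerDist (pos a)
  potential-lipschitz (inner⁺ {a} {b} b≡a+2) = innerDist-lipschitz (proj₂ (pos-step {a} {b} 2 2≤k b≡a+2))
  potential-lipschitz (inner⁻ {a} {b} a≡b+2) = innerDist-lipschitz (proj₁ (pos-step {b} {a} 2 2≤k a≡b+2))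

  potential≡0⇒≡u-j : ∀ {x} → potential x ≡ 0 → x ≡ u j
  potential≡0⇒≡u-j {u a} eq = cong u (pos≡0⇒≡j (outerDist≡0⇒≡0 eq))

  open Descent (u j) potential nbrs ∈nbrs⇒Adj Adj⇒∈nbrs nbrs-unique potential-lipschitz
               potential≡0⇒≡u-j (cong outerDist pos-j)

  count-recurrence : ∀ x m → potential x ≡ suc m → sumAtLevel count m (nbrs x) ≡ count x
  count-recurrence (u a) m eq = trans (sum-over-pair (outerAt m) (innerAt m (pos a)) (pos-shift a 1 1≤k))
                                      (outer-recurrence (pos a) m (‖‖≤k _) eq)
  count-recurrence (v a) m eq = trans (sum-over-pair (innerAt m) (outerAt m (pos a)) (pos-shift a 2 2≤k))
                                      (inner-recurrence (pos a) m (‖‖≤k _) eq)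

  σ≡outerCount : ∀ i → ∣ toℕ i - toℕ j ∣ ≤ k →
    σ_,_≡_in-GP2_ (u i) (u j) (outerCount ∣ toℕ i - toℕ j ∣)
  σ≡outerCount i r≤k = subst (σ_,_≡_in-GP2_ (u i) (u j)) (cong outerCount (pos≡∣-∣ i r≤k))
    (σ-by-recurrence count (cong outerCount pos-j) count-recurrence (u i) (outerCount≥1 (pos i)))

-- The hypothesis i ≢ j is not needed: no case of the statement applies when r ≡ 0.
mainTheorem3 : (k : ℕ) → 2 ≤ k → (i j : Fin (suc (2 * k))) → i ≢ j
    → ∣ toℕ i - toℕ j ∣ ≤ k
    → let r = ∣ toℕ i - toℕ j ∣
          σ = σ_,_≡_in-GP2_ (u i) (u j)
      in ((r ≡ 1 ⊎ r ≡ 2 ⊎ r ≡ 3) → σ 1)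
         × (r ≡ 4 → σ 2)
         × (r ≡ 5 → r < k → σ 3)
         × (r ≡ 5 → r ≡ k → σ 4)
         × (6 ≤ r → r % 2 ≡ 0 → σ 1)
         × (7 ≤ r → r % 2 ≡ 1 → r < k → σ 2)
         × (7 ≤ r → r % 2 ≡ 1 → r ≡ k → σ 3)
mainTheorem3 k 2≤k i j _ r≤k =
  [ σ-at , [ σ-at , σ-at ] ] , σ-at ,
  (λ r≡5 r<k →
    σ-by (trans (cong outerCount r≡5) (cong (2 +_) (innerCount-≢ (<⇒≢ (subst (_< k) r≡5 r<k)))))) ,
  (λ r≡5 r≡k → σ-by (trans (cong outerCount r≡5) (cong (2 +_) (innerCount-at-k (trans (sym r≡5) r≡k))))) ,
  (λ 6≤r r%2≡0 → σ-by (outerCount-even r 6≤r r%2≡0)) ,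
  (λ 7≤r r%2≡1 r<k → σ-by (trans (outerCount-odd r 7≤r r%2≡1) (cong suc (innerCount-≢ (<⇒≢ r<k))))) ,
  (λ 7≤r r%2≡1 r≡k →
    σ-by (trans (outerCount-odd r 7≤r r%2≡1) (cong suc (trans (innerCount-at-k r≡k) (cong suc r%2≡1)))))
  where
  open PetersenGP k 2≤k j
  open Counts k 2≤k
  r = ∣ toℕ i - toℕ j ∣
  σ-by : ∀ {c} → outerCount r ≡ c → σ_,_≡_in-GP2_ (u i) (u j) c
  σ-by eq = subst (σ_,_≡_in-GP2_ (u i) (u j)) eq (σ≡outerCount i r≤k)
  σ-at : ∀ {s} → r ≡ s → σ_,_≡_in-GP2_ (u i) (u j) (outerCount s)
  σ-at r≡s = σ-by (cong outerCount r≡s)
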